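{- Let $\mathbf{v}=(v_1, v_2, \ldots, v_m)$ and $\mathbf{k}=(k_1, k_2, \ldots, k_m)$, and suppose there exists a $t$-$(\mathbf{v},\mathbf{k},\lambda)$ generalized packing with $N$ blocks. Then for all $i,j\in \{1, 2, \ldots, m\}$ with $i < j$, there exists a $t$-$(\mathbf{v}^+,\mathbf{k}^+,\lambda)$ generalized packing with $N$ blocks, where $$\mathbf{v}^+=(v_1, \ldots, v_{i-1}, v_{i+1}, \ldots, v_{j-1}, v_{j+1}, \ldots, v_m,v_i+v_j)$$ and $$\mathbf{k}^+=(k_1, \ldots, k_{i-1}, k_{i+1}, \ldots, k_{j-1}, k_{j+1}, \ldots, k_m,k_i+k_j).$$ In particular, $D_\lambda(\mathbf{v}^+,\mathbf{k}^+,t) \geq D_\lambda(\mathbf{v},\mathbf{k},t)$.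
   Context: Let $v,k,t,\lambda$ be integers with $v\geq k\geq t\geq 1$ and $\lambda\geq 1$. Let $\mathbf{v}=(v_1,\ldots,v_m)$ be an $m$-tuple of positive integers with sum $v$ and $\mathbf{k}=(k_1,\ldots,k_m)$ an $m$-tuple of positive integers with sum $k$, with $k_i\leq v_i$ for all $i$. Let $\mathbf{X}=(X_1,\ldots,X_m)$ be pairwise disjoint sets with $|X_i|=v_i$. A $t$-$(\mathbf{v},\mathbf{k},\lambda)$ generalized packing is a family of blocks $(B_1,\ldots,B_m)$ with each $B_i$ a $k_i$-subset of $X_i$, such that every $m$-tuple $(T_1,\ldots,T_m)$ with $T_i\subseteq X_i$, $|T_i|=t_i$, where the $t_i$ are non-negative integers with $t_i\leq k_i$ and $\sum t_i=t$, is contained (componentwise) in at most $\lambda$ blocks. $D_\lambda(\mathbf{v},\mathbf{k},t)$ denotes the maximum possible number of blocks in such a generalized packing. -}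

module Defs where

open import Data.Nat using (ℕ; zero; suc; _+_; _≤_; _<_)
open import Data.Nat.Properties using (<-≤-trans; ≤-pred)
open import Data.Fin using (Fin; toℕ; fromℕ<)
open import Data.Fin.Properties using (toℕ<n; all?)
open import Data.Fin.Subset using (Subset; _⊆_; ∣_∣)
open import Data.Fin.Subset.Properties using (_⊆?_)
open import Data.Vec using (Vec; lookup; tabulate; sum; removeAt; _∷ʳ_)
open import Data.List using (List; length; filter)
open import Data.Product using (Σ; proj₁; _×_)
open import Relation.Nullary using (Dec)
open import Relation.Binary.PropositionalEquality using (_≡_)

-- Ground sets: X_i = Fin (v_i); the X_i are disjoint by construction
-- (a tuple indexed by i).

Block : {m : ℕ} → Vec ℕ m → Vec ℕ m → Set
Block {m} v k = (i : Fin m) → Σ (Subset (lookup v i)) (λ B → ∣ B ∣ ≡ lookup k i)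

Tuple : {m : ℕ} → Vec ℕ m → Set
Tuple {m} v = (i : Fin m) → Subset (lookup v i)

Admissible : {m : ℕ} (v k : Vec ℕ m) (t : ℕ) → Tuple v → Set
Admissible {m} v k t T = ((i : Fin m) → ∣ T i ∣ ≤ lookup k i) × (sum (tabulate (λ i → ∣ T i ∣)) ≡ t)

Contained : {m : ℕ} (v k : Vec ℕ m) → Tuple v → Block v k → Set
Contained {m} v k T B = (i : Fin m) → T i ⊆ proj₁ (B i)

contained? : {m : ℕ} (v k : Vec ℕ m) (T : Tuple v) (B : Block v k) → Dec (Contained v k T B)
contained? v k T B = all? (λ i → T i ⊆? proj₁ (B i))

-- Number of blocks of the family (a list, so repeated blocks allowed)
-- containing T.
count : {m : ℕ} (v k : Vec ℕ m) → Tuple v → List (Block v k) → ℕ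
count v k T Bs = length (filter (λ B → contained? v k T B) Bs)

GenPacking : {m : ℕ} (v k : Vec ℕ m) (t lam N : ℕ) → Set
GenPacking v k t lam N =
  Σ (List (Block v k)) (λ Bs →
    (length Bs ≡ N) ×
    ((T : Tuple v) → Admissible v k t T → count v k T Bs ≤ lam))

merge : {n : ℕ} (a : Vec ℕ (suc (suc n))) (i j : Fin (suc (suc n))) →
        toℕ i < toℕ j → Vec ℕ (suc n)
merge {n} a i j i<j =
  removeAt (removeAt a j) (fromℕ< (<-≤-trans i<j (≤-pred (toℕ<n j))))
    ∷ʳ (lookup a i + lookup a j)

module Submission where

-- Given a t-(v,k,λ) packing and coordinates i < j, glue in every block
-- the parts B_i ⊆ X_i and B_j ⊆ X_j into the single part B_i ++ B_j of the
-- new last ground set X_i ⊎ X_j (realised as Fin (v_i + v_j)) and keep the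
-- remaining parts.  Conversely, a tuple T' for the merged parameters splits
-- into a tuple T for (v,k): T_i and T_j are the two halves of the last
-- component of T', the other components are copied.  Splitting preserves the
-- total size, and T' lies in a glued block only if its split lies in the
-- original block; so T' lies in at most as many glued blocks as its split T
-- lies in original blocks, which is at most λ because T, lying in some
-- block, is automatically admissible.

open import Defs
open import Data.Nat using (ℕ; suc; _≤_; _<_)
open import Data.Fin using (Fin; toℕ)
open import Data.Vec using (Vec; lookup; sum)

open import Level using (Level)
open import Data.Nat using (zero; _+_; z≤n; s≤s)
open import Data.Nat.Properties using (+-0-commutativeMonoid; +-comm; +-assoc; ≤-trans; m≤n⇒m≤1+n; <-irrefl; <-≤-trans; ≤-pred)
open import Data.Fin using (zero; suc; inject₁; fromℕ; fromℕ<; punchIn; punchOut)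
open import Data.Fin.Properties using (_≟_; toℕ<n; toℕ-fromℕ<; toℕ-injective; punchIn-injective; punchInᵢ≢i; punchIn-punchOut; punchOut-punchIn)
open import Data.Fin.Relation.Unary.Top as Top using (‵fromℕ; ‵inject₁)
open import Data.Fin.Subset using (Subset; _⊆_; ∣_∣; inside; outside)
open import Data.Fin.Subset.Properties using (p⊆q⇒∣p∣≤∣q∣; drop-∷-⊆)
open import Data.Vec using ([]; _∷_; _++_; take; drop; tabulate; removeAt; _∷ʳ_; here; there)
open import Data.Vec.Properties using (removeAt-punchOut; take++drop≡id)
open import Data.List using (List; length; filter; map)
open import Data.List.Properties using (length-map)
open import Data.Product using (Σ; ∃; _,_; proj₁; proj₂; _×_)
open import Data.Empty using (⊥-elim)
open import Function using (_∘_)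
open import Relation.Nullary using (yes; no; ¬_)
open import Relation.Unary using (Pred; Decidable)
open import Relation.Binary.PropositionalEquality using (_≡_; refl; sym; trans; cong; cong₂; subst; module ≡-Reasoning)
open import Axiom.UniquenessOfIdentityProofs using (module Decidable⇒UIP)
import Algebra.Properties.CommutativeMonoid.Sum as MonoidSum

module ∑ = MonoidSum +-0-commutativeMonoid

module _ {a b p q : Level} {A : Set a} {B : Set b} where

  length-filter-map-≤ : {P : Pred B p} {Q : Pred A q} (P? : Decidable P) (Q? : Decidable Q)
    (f : A → B) → (∀ x → P (f x) → Q x) →
    (xs : List A) → length (filter P? (map f xs)) ≤ length (filter Q? xs)
  length-filter-map-≤ P? Q? f P⇒Q List.[] = z≤n
  length-filter-map-≤ P? Q? f P⇒Q (x List.∷ xs) with P? (f x) | Q? x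
  ... | yes _  | yes _  = s≤s (length-filter-map-≤ P? Q? f P⇒Q xs)
  ... | yes px | no ¬qx = ⊥-elim (¬qx (P⇒Q x px))
  ... | no _   | yes _  = m≤n⇒m≤1+n (length-filter-map-≤ P? Q? f P⇒Q xs)
  ... | no _   | no _   = length-filter-map-≤ P? Q? f P⇒Q xs

module _ {a q : Level} {A : Set a} where

  filter-witness : {Q : Pred A q} (Q? : Decidable Q) (xs : List A) →
    0 < length (filter Q? xs) → ∃ Q
  filter-witness Q? (x List.∷ xs) nonempty with Q? x
  ... | yes qx = x , qx
  ... | no _   = filter-witness Q? xs nonempty

size : {m : ℕ} (v : Vec ℕ m) → Tuple v → ℕ
size v T = sum (tabulate (λ r → ∣ T r ∣))

module _ {m : ℕ} (v k : Vec ℕ m) where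

  contained⇒bounded : (T : Tuple v) (B : Block v k) → Contained v k T B →
    (r : Fin m) → ∣ T r ∣ ≤ lookup k r
  contained⇒bounded T B T⊆B r = subst (∣ T r ∣ ≤_) (proj₂ (B r)) (p⊆q⇒∣p∣≤∣q∣ (T⊆B r))

  -- In a packing every tuple of total size t lies in at most λ blocks,
  -- admissible or not: a tuple lying in some block is admissible.
  packing-bound : {t lam : ℕ} (Bs : List (Block v k)) →
    ((T : Tuple v) → Admissible v k t T → count v k T Bs ≤ lam) →
    (T : Tuple v) → size v T ≡ t → count v k T Bs ≤ lam
  packing-bound Bs packing T size≡t with count v k T Bs in count≡
  ... | zero  = z≤n
  ... | suc _ = subst (_≤ _) count≡ (packing T (contained⇒bounded T B T⊆B , size≡t))
    where
    inBlock : ∃ (Contained v k T)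
    inBlock = filter-witness (contained? v k T) Bs (subst (0 <_) (sym count≡) (s≤s z≤n))
    B : Block v k
    B = proj₁ inBlock
    T⊆B : Contained v k T B
    T⊆B = proj₂ inBlock

transfer : {m m' : ℕ} (v k : Vec ℕ m) (v' k' : Vec ℕ m') {t lam N : ℕ}
  (glue : Block v k → Block v' k') (split : Tuple v' → Tuple v) →
  ((T' : Tuple v') (B : Block v k) → Contained v' k' T' (glue B) → Contained v k (split T') B) →
  ((T' : Tuple v') → size v (split T') ≡ size v' T') →
  GenPacking v k t lam N → GenPacking v' k' t lam N
transfer v k v' k' glue split reflects sizes (Bs , length≡N , packing) =
  map glue Bs , trans (length-map glue Bs) length≡N , bound
  where
  bound : (T' : Tuple v') → Admissible v' k' _ T' → count v' k' T' (map glue Bs) ≤ _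
  bound T' (_ , size≡t) = ≤-trans
    (length-filter-map-≤ (contained? v' k' T') (contained? v k (split T')) glue (reflects T') Bs)
    (packing-bound v k Bs packing (split T') (trans (sizes T') size≡t))

Sized : ℕ → ℕ → Set
Sized a b = Σ (Subset a) (λ X → ∣ X ∣ ≡ b)

∣subst∣ : {a a' : ℕ} (e : a ≡ a') (X : Subset a) → ∣ subst Subset e X ∣ ≡ ∣ X ∣
∣subst∣ refl X = refl

retype : {a a' b b' : ℕ} → a ≡ a' → b ≡ b' → Sized a b → Sized a' b'
retype ea eb X = subst Subset ea (proj₁ X) , trans (∣subst∣ ea (proj₁ X)) (trans (proj₂ X) eb)

⊆-subst : {a a' : ℕ} (e : a ≡ a') {X : Subset a'} {Y : Subset a} →
  X ⊆ subst Subset e Y → subst Subset (sym e) X ⊆ Y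
⊆-subst refl X⊆Y = X⊆Y

∣++∣ : {a b : ℕ} (X : Subset a) (Y : Subset b) → ∣ X ++ Y ∣ ≡ ∣ X ∣ + ∣ Y ∣
∣++∣ [] Y = refl
∣++∣ (inside ∷ X) Y = cong suc (∣++∣ X Y)
∣++∣ (outside ∷ X) Y = ∣++∣ X Y

_++ˢ_ : {a b c d : ℕ} → Sized a c → Sized b d → Sized (a + b) (c + d)
X ++ˢ Y = proj₁ X ++ proj₁ Y , trans (∣++∣ (proj₁ X) (proj₁ Y)) (cong₂ _+_ (proj₂ X) (proj₂ Y))

⊆-++⁻ : {a b : ℕ} (X Y : Subset a) {Z W : Subset b} → X ++ Z ⊆ Y ++ W → X ⊆ Y × Z ⊆ W
⊆-++⁻ [] [] XZ⊆YW = (λ ()) , XZ⊆YW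
⊆-++⁻ (x ∷ X) (y ∷ Y) XZ⊆YW = head⊆ , proj₂ (⊆-++⁻ X Y (drop-∷-⊆ XZ⊆YW))
  where
  head⊆ : x ∷ X ⊆ y ∷ Y
  head⊆ here with XZ⊆YW here
  ... | here = here
  head⊆ (there z∈X) = there (proj₁ (⊆-++⁻ X Y (drop-∷-⊆ XZ⊆YW)) z∈X)

module _ {a : Level} {A : Set a} where

  lookup-∷ʳ-inject₁ : {n : ℕ} (xs : Vec A n) (x : A) (s : Fin n) →
    lookup (xs ∷ʳ x) (inject₁ s) ≡ lookup xs s
  lookup-∷ʳ-inject₁ (y ∷ xs) x zero = refl
  lookup-∷ʳ-inject₁ (y ∷ xs) x (suc s) = lookup-∷ʳ-inject₁ xs x s

  lookup-∷ʳ-last : {n : ℕ} (xs : Vec A n) (x : A) → lookup (xs ∷ʳ x) (fromℕ n) ≡ x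
  lookup-∷ʳ-last [] x = refl
  lookup-∷ʳ-last (y ∷ xs) x = lookup-∷ʳ-last xs x

  lookup-removeAt : {n : ℕ} (xs : Vec A (suc n)) (r : Fin (suc n)) (s : Fin n) →
    lookup (removeAt xs r) s ≡ lookup xs (punchIn r s)
  lookup-removeAt xs r s = trans
    (cong (lookup (removeAt xs r)) (sym (punchOut-punchIn r)))
    (removeAt-punchOut xs (punchInᵢ≢i r s ∘ sym))

toℕ-punchIn-below : {n : ℕ} (r : Fin (suc n)) (x : Fin n) → toℕ x < toℕ r → toℕ (punchIn r x) ≡ toℕ x
toℕ-punchIn-below (suc r) zero x<r = refl
toℕ-punchIn-below (suc r) (suc x) (s≤s x<r) = cong suc (toℕ-punchIn-below r x x<r)

sum-tabulate : {n : ℕ} (f : Fin n → ℕ) → sum (tabulate f) ≡ ∑.sum f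
sum-tabulate {zero} f = refl
sum-tabulate {suc n} f = cong (f zero +_) (sum-tabulate (f ∘ suc))

-- Index arithmetic of `merge`: the old coordinates other than i, j are
-- σ 0, ..., σ (n-1), which become the first n merged coordinates.

module MergeIndices {n : ℕ} (i j : Fin (suc (suc n))) (i<j : toℕ i < toℕ j) where

  -- The position of i once j is removed (as in the definition of merge).
  p : Fin (suc n)
  p = fromℕ< (<-≤-trans i<j (≤-pred (toℕ<n j)))

  σ : Fin n → Fin (suc (suc n))
  σ s = punchIn j (punchIn p s)

  merge-inner : (a : Vec ℕ (suc (suc n))) (s : Fin n) →
    lookup a (σ s) ≡ lookup (merge a i j i<j) (inject₁ s)
  merge-inner a s = sym (begin
    lookup (merge a i j i<j) (inject₁ s)  ≡⟨ lookup-∷ʳ-inject₁ (removeAt (removeAt a j) p) _ s ⟩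
    lookup (removeAt (removeAt a j) p) s  ≡⟨ lookup-removeAt (removeAt a j) p s ⟩
    lookup (removeAt a j) (punchIn p s)   ≡⟨ lookup-removeAt a j (punchIn p s) ⟩
    lookup a (σ s)                        ∎)
    where open ≡-Reasoning

  merge-last : (a : Vec ℕ (suc (suc n))) → lookup a i + lookup a j ≡ lookup (merge a i j i<j) (fromℕ n)
  merge-last a = sym (lookup-∷ʳ-last (removeAt (removeAt a j) p) (lookup a i + lookup a j))

  punchIn-p : punchIn j p ≡ i
  punchIn-p = toℕ-injective (trans (toℕ-punchIn-below j p p<j) toℕp≡toℕi)
    where
    toℕp≡toℕi : toℕ p ≡ toℕ i
    toℕp≡toℕi = toℕ-fromℕ< _
    p<j : toℕ p < toℕ j
    p<j = subst (_< toℕ j) (sym toℕp≡toℕi) i<j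

  i≢j : ¬ (i ≡ j)
  i≢j i≡j = <-irrefl (cong toℕ i≡j) i<j

  σ≢i : (s : Fin n) → ¬ (σ s ≡ i)
  σ≢i s σs≡i = punchInᵢ≢i p s (punchIn-injective j _ _ (trans σs≡i (sym punchIn-p)))

  σ≢j : (s : Fin n) → ¬ (σ s ≡ j)
  σ≢j s = punchInᵢ≢i j (punchIn p s)

  σ-injective : {s s' : Fin n} → σ s ≡ σ s' → s ≡ s'
  σ-injective e = punchIn-injective p _ _ (punchIn-injective j _ _ e)

  data Part (q : Fin (suc (suc n))) : Set where
    first  : q ≡ i → Part q
    second : q ≡ j → Part q
    inner  : (s : Fin n) → q ≡ σ s → Part q

  part : (q : Fin (suc (suc n))) → Part q
  part q with j ≟ q
  ... | yes j≡q = second (sym j≡q)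
  ... | no j≢q with punchOut j≢q ≟ p
  ...   | yes q'≡p = first (trans (sym (punchIn-punchOut j≢q)) (trans (cong (punchIn j) q'≡p) punchIn-p))
  ...   | no q'≢p = inner (punchOut (q'≢p ∘ sym))
    (sym (trans (cong (punchIn j) (punchIn-punchOut (q'≢p ∘ sym))) (punchIn-punchOut j≢q)))

  part-unique : {q : Fin (suc (suc n))} (w w' : Part q) → w ≡ w'
  part-unique (first e)   (first e')    = cong first (Decidable⇒UIP.≡-irrelevant _≟_ e e')
  part-unique (first e)   (second e')   = ⊥-elim (i≢j (trans (sym e) e'))
  part-unique (first e)   (inner s e')  = ⊥-elim (σ≢i s (trans (sym e') e))
  part-unique (second e)  (first e')    = ⊥-elim (i≢j (trans (sym e') e))
  part-unique (second e)  (second e')   = cong second (Decidable⇒UIP.≡-irrelevant _≟_ e e')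
  part-unique (second e)  (inner s e')  = ⊥-elim (σ≢j s (trans (sym e') e))
  part-unique (inner s e) (first e')    = ⊥-elim (σ≢i s (trans (sym e) e'))
  part-unique (inner s e) (second e')   = ⊥-elim (σ≢j s (trans (sym e) e'))
  part-unique (inner s e) (inner s' e') with σ-injective (trans (sym e) e')
  ... | refl = cong (inner s) (Decidable⇒UIP.≡-irrelevant _≟_ e e')

module MergeConstruction {n : ℕ} (i j : Fin (suc (suc n))) (i<j : toℕ i < toℕ j)
                         (v k : Vec ℕ (suc (suc n))) where

  open MergeIndices i j i<j

  v' k' : Vec ℕ (suc n)
  v' = merge v i j i<j
  k' = merge k i j i<j

  last : Fin (suc n)
  last = fromℕ n

  glueAt : Block v k → (r : Fin (suc n)) → Top.View r → Sized (lookup v' r) (lookup k' r)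
  glueAt B .(fromℕ n) ‵fromℕ = retype (merge-last v) (merge-last k) (B i ++ˢ B j)
  glueAt B .(inject₁ s) (‵inject₁ s) = retype (merge-inner v s) (merge-inner k s) (B (σ s))

  glue : Block v k → Block v' k'
  glue B r = glueAt B r (Top.view r)

  glue-last : (B : Block v k) →
    proj₁ (glue B last) ≡ subst Subset (merge-last v) (proj₁ (B i) ++ proj₁ (B j))
  glue-last B rewrite Top.view-fromℕ n = refl

  glue-inner : (B : Block v k) (s : Fin n) →
    proj₁ (glue B (inject₁ s)) ≡ subst Subset (merge-inner v s) (proj₁ (B (σ s)))
  glue-inner B s rewrite Top.view-inject₁ s = refl

  joint : Tuple v' → Subset (lookup v i + lookup v j)
  joint T' = subst Subset (sym (merge-last v)) (T' last)

  splitAt : Tuple v' → (q : Fin (suc (suc n))) → Part q → Subset (lookup v q)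
  splitAt T' q (first refl)    = take (lookup v i) (joint T')
  splitAt T' q (second refl)   = drop (lookup v i) (joint T')
  splitAt T' q (inner s refl)  = subst Subset (sym (merge-inner v s)) (T' (inject₁ s))

  split : Tuple v' → Tuple v
  split T' q = splitAt T' q (part q)

  split-first : (T' : Tuple v') → split T' i ≡ take (lookup v i) (joint T')
  split-first T' = cong (splitAt T' i) (part-unique (part i) (first refl))

  split-second : (T' : Tuple v') → split T' j ≡ drop (lookup v i) (joint T')
  split-second T' = cong (splitAt T' j) (part-unique (part j) (second refl))

  split-inner : (T' : Tuple v') (s : Fin n) →
    split T' (σ s) ≡ subst Subset (sym (merge-inner v s)) (T' (inject₁ s))
  split-inner T' s = cong (splitAt T' (σ s)) (part-unique (part (σ s)) (inner s refl))

  split-reflects : (T' : Tuple v') (B : Block v k) →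
    Contained v' k' T' (glue B) → Contained v k (split T') B
  split-reflects T' B T'⊆B' q = go q (part q)
    where
    joint⊆ : joint T' ⊆ proj₁ (B i) ++ proj₁ (B j)
    joint⊆ = ⊆-subst (merge-last v) (subst (T' last ⊆_) (glue-last B) (T'⊆B' last))
    halves⊆ : take (lookup v i) (joint T') ⊆ proj₁ (B i) × drop (lookup v i) (joint T') ⊆ proj₁ (B j)
    halves⊆ = ⊆-++⁻ _ _ (subst (_⊆ _) (sym (take++drop≡id (lookup v i) (joint T'))) joint⊆)
    go : (q : Fin (suc (suc n))) (w : Part q) → splitAt T' q w ⊆ proj₁ (B q)
    go q (first refl)   = proj₁ halves⊆
    go q (second refl)  = proj₂ halves⊆
    go q (inner s refl) = ⊆-subst (merge-inner v s)
      (subst (T' (inject₁ s) ⊆_) (glue-inner B s) (T'⊆B' (inject₁ s)))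

  split-size : (T' : Tuple v') → size v (split T') ≡ size v' T'
  split-size T' = begin
    size v (split T')                 ≡⟨ sum-tabulate c ⟩
    ∑.sum c                           ≡⟨ ∑.sum-remove {i = j} c ⟩
    c j + ∑.sum (c ∘ punchIn j)       ≡⟨ cong (c j +_) (∑.sum-remove {i = p} (c ∘ punchIn j)) ⟩
    c j + (c (punchIn j p) + ∑σ)      ≡⟨ cong (λ x → c j + (c x + ∑σ)) punchIn-p ⟩
    c j + (c i + ∑σ)                  ≡⟨ sym (+-assoc (c j) (c i) ∑σ) ⟩
    c j + c i + ∑σ                    ≡⟨ cong (_+ ∑σ) (+-comm (c j) (c i)) ⟩
    c i + c j + ∑σ                    ≡⟨ cong (_+ ∑σ) halves ⟩
    d last + ∑σ                       ≡⟨ +-comm (d last) ∑σ ⟩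
    ∑σ + d last                       ≡⟨ cong (_+ d last) (∑.sum-cong-≗ inner-sizes) ⟩
    ∑.sum (d ∘ inject₁) + d last      ≡⟨ sym (∑.sum-init-last d) ⟩
    ∑.sum d                           ≡⟨ sym (sum-tabulate d) ⟩
    size v' T'                        ∎
    where
    open ≡-Reasoning
    c : Fin (suc (suc n)) → ℕ
    c q = ∣ split T' q ∣
    d : Fin (suc n) → ℕ
    d r = ∣ T' r ∣
    ∑σ : ℕ
    ∑σ = ∑.sum (c ∘ σ)
    J : Subset (lookup v i + lookup v j)
    J = joint T'
    halves : c i + c j ≡ d last
    halves = begin
      c i + c j                                    ≡⟨ cong₂ (λ X Y → ∣ X ∣ + ∣ Y ∣) (split-first T') (split-second T') ⟩
      ∣ take (lookup v i) J ∣ + ∣ drop (lookup v i) J ∣ ≡⟨ sym (∣++∣ (take (lookup v i) J) _) ⟩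
      ∣ take (lookup v i) J ++ drop (lookup v i) J ∣ ≡⟨ cong ∣_∣ (take++drop≡id (lookup v i) J) ⟩
      ∣ J ∣                                        ≡⟨ ∣subst∣ (sym (merge-last v)) (T' last) ⟩
      d last                                       ∎
    inner-sizes : (s : Fin n) → c (σ s) ≡ d (inject₁ s)
    inner-sizes s = trans (cong ∣_∣ (split-inner T' s)) (∣subst∣ (sym (merge-inner v s)) (T' (inject₁ s)))

proposition3p6 : (n : ℕ) (v k : Vec ℕ (suc (suc n))) (t lam N : ℕ) →
    ((r : Fin (suc (suc n))) → 1 ≤ lookup k r) →
    ((r : Fin (suc (suc n))) → lookup k r ≤ lookup v r) →
    1 ≤ t → t ≤ sum k → 1 ≤ lam →
    GenPacking v k t lam N →
    (i j : Fin (suc (suc n))) → (i<j : toℕ i < toℕ j) →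
    GenPacking (merge v i j i<j) (merge k i j i<j) t lam N
proposition3p6 n v k t lam N _ _ _ _ _ packing i j i<j =
  transfer v k v' k' glue split split-reflects split-size packing
  where open MergeConstruction i j i<j v k
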